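{- A finite simple graph $G$ is s-collapsible if and only if its suspension $SG$ is s-collapsible.
   Context: Graphs are finite, undirected, without loops or multiple edges. $N_G(g)$ is the set of neighbours of $g$, $N_G[g]=N_G(g)\cup\{g\}$; vertex sets are identified with induced subgraphs. A vertex $g$ is dominated by $g'\ne g$ if $N_G[g]\subseteq N_G[g']$. A graph is dismantlable if it has one vertex, or its vertices can be listed $g_1,\dots,g_n$ so that each $g_i$ ($2\le i\le n$) is dominated by another vertex in the subgraph induced by $\{g_1,\dots,g_i\}$. A vertex $g$ is s-dismantlable in $G$ if $N_G(g)$ is dismantlable. A graph $G$ is s-collapsible if its vertices can be listed $g_1,\dots,g_n$ ($n\ge1$) so that each $g_i$ ($2\le i\le n$) is s-dismantlable in the subgraph induced by $\{g_1,\dots,g_i\}$. The suspension $SG$ has vertex set $V(G)\cup\{x,y\}$ with two new vertices $x\ne y$, and edges $E(G)$ together with all $xg$ and $yg$ for $g\in V(G)$. -}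

module Defs where

open import Data.Bool using (Bool; true; false; T)
open import Data.Nat using (ℕ; suc)
open import Data.Fin using (Fin; zero; suc)
open import Data.List using (List; []; _∷_)
open import Data.List.Membership.Propositional using (_∈_)
open import Data.List.Relation.Unary.Unique.Propositional using (Unique)
open import Data.Product using (Σ; ∃; ∃-syntax; _×_; _,_)
open import Data.Sum using (_⊎_)
open import Function.Bundles using (_⇔_)
open import Relation.Binary.PropositionalEquality using (_≡_; _≢_; refl)

record Graph (n : ℕ) : Set where
  field
    adj    : Fin n → Fin n → Bool
    sym    : ∀ g h → adj g h ≡ adj h g
    irrefl : ∀ g → adj g g ≡ false

open Graph public

module _ {n : ℕ} (G : Graph n) where

  Adj : Fin n → Fin n → Set
  Adj g h = T (adj G g h)

  -- h ∈ N_H[g], where H is the subgraph induced by the vertex list S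
  -- (membership of h in S is required separately)
  ClosedNbr : Fin n → Fin n → Set
  ClosedNbr g h = h ≡ g ⊎ Adj g h

  DominatedIn : Fin n → List (Fin n) → Set
  DominatedIn g S =
    ∃[ g' ] (g' ∈ S × g' ≢ g ×
             (∀ h → h ∈ S → ClosedNbr g h → ClosedNbr g' h))

  -- Elimination sequence: a list  g_k ∷ g_{k-1} ∷ … ∷ g_1 ∷ []
  -- (i.e. the listing g_1,…,g_k written in reverse, last vertex first),
  -- nonempty, such that each g_i with i ≥ 2 satisfies P g_i {g_1,…,g_i}.
  data Seq (P : Fin n → List (Fin n) → Set) : List (Fin n) → Set where
    one  : ∀ g → Seq P (g ∷ [])
    step : ∀ {g rest} → Seq P rest → P g (g ∷ rest) → Seq P (g ∷ rest)

  Dismantlable : (Fin n → Set) → Set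
  Dismantlable U =
    ∃[ l ] (Unique l × (∀ v → v ∈ l ⇔ U v) × Seq DominatedIn l)

  SDismantlableIn : Fin n → List (Fin n) → Set
  SDismantlableIn g S = Dismantlable (λ v → v ∈ S × Adj g v)

  SCollapsible : Set
  SCollapsible =
    ∃[ l ] (Unique l × (∀ v → v ∈ l) × Seq SDismantlableIn l)

-- Suspension: vertex set Fin (2 + n); zero = x, suc zero = y,
-- suc (suc g) = the vertex g of G.
suspAdj : ∀ {n} → Graph n → Fin (suc (suc n)) → Fin (suc (suc n)) → Bool
suspAdj G zero          zero          = false
suspAdj G zero          (suc zero)    = false
suspAdj G zero          (suc (suc h)) = true
suspAdj G (suc zero)    zero          = false
suspAdj G (suc zero)    (suc zero)    = false
suspAdj G (suc zero)    (suc (suc h)) = true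
suspAdj G (suc (suc g)) zero          = true
suspAdj G (suc (suc g)) (suc zero)    = true
suspAdj G (suc (suc g)) (suc (suc h)) = adj G g h

suspSym : ∀ {n} (G : Graph n) g h → suspAdj G g h ≡ suspAdj G h g
suspSym G zero          zero          = refl
suspSym G zero          (suc zero)    = refl
suspSym G zero          (suc (suc h)) = refl
suspSym G (suc zero)    zero          = refl
suspSym G (suc zero)    (suc zero)    = refl
suspSym G (suc zero)    (suc (suc h)) = refl
suspSym G (suc (suc g)) zero          = refl
suspSym G (suc (suc g)) (suc zero)    = refl
suspSym G (suc (suc g)) (suc (suc h)) = sym G g h

suspIrrefl : ∀ {n} (G : Graph n) g → suspAdj G g g ≡ false
suspIrrefl G zero          = refl
suspIrrefl G (suc zero)    = refl
suspIrrefl G (suc (suc g)) = irrefl G g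

Susp : ∀ {n} → Graph n → Graph (suc (suc n))
Susp G = record { adj = suspAdj G ; sym = suspSym G ; irrefl = suspIrrefl G }

-- A dominated vertex has a cone as link, so dismantlable graphs are
-- s-collapsible.  In the suspension, the link of a vertex g of G among
-- vertices that include both poles is the suspension of its link in G, and
-- such a relative suspension is dismantlable exactly when its base is: a
-- dominated vertex of the base stays dominated, and conversely, once both
-- poles are present, a vertex of G can only be dominated by a vertex of G
-- (a pole misses the other pole).  Hence a collapsing order g₁, …, g_k of G
-- gives the order g₁, x, y, g₂, …, g_k of SG.  Conversely, read a collapsing
-- order of SG backwards down to the pole p added last: after p every link
-- desuspends, and the link of p consists of vertices of G only, so the
-- vertices of G before p form a dismantlable, hence s-collapsible, graph.
module Submission where

open import Defs
open import Data.Bool using (T)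
open import Data.Bool.Properties using (T?)
open import Data.Empty using (⊥-elim)
open import Data.Fin using (Fin; zero; suc)
open import Data.Fin.Properties using (_≟_)
open import Data.List using (List; []; _∷_; _++_; map; filter; allFin)
open import Data.List.Membership.Propositional using (_∈_; _∉_)
open import Data.List.Membership.Propositional.Properties
  using (∈-++⁺ʳ; ∈-++⁺ˡ; ∈-++⁻; ∈-filter⁺; ∈-filter⁻; ∈-allFin; ∈-map⁺; ∈-map⁻)
import Data.List.Membership.DecPropositional as DecMembership
open import Data.List.Relation.Unary.All using (All; []; _∷_)
open import Data.List.Relation.Unary.All.Properties using (¬Any⇒All¬; All¬⇒¬Any)
open import Data.List.Relation.Unary.AllPairs using ([]; _∷_)
open import Data.List.Relation.Unary.Any using (here; there)
open import Data.List.Relation.Unary.Unique.Propositional using (Unique)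
import Data.List.Relation.Unary.Unique.Propositional.Properties as Unique
open import Data.Nat using (ℕ; _+_)
open import Data.Product using (∃-syntax; _×_; _,_; proj₁; proj₂)
import Data.Product as Product
open import Data.Sum using (inj₁; inj₂; map₁)
open import Data.Unit using (tt)
open import Function.Base using (_∘_; const)
open import Function.Bundles using (_⇔_; mk⇔; Equivalence)
open import Function.Construct.Composition using (_⇔-∘_)
open import Function.Construct.Symmetry using (⇔-sym)
open import Relation.Binary.PropositionalEquality using (_≡_; _≢_; refl; cong; subst)
open import Relation.Nullary using (yes; no)
open import Relation.Nullary.Decidable using (_×-dec_; ¬?)
open import Relation.Unary using (Decidable)

open Equivalence using (to; from)

map-preimage : ∀ {A B : Set} (f : A → B) (ys : List B) →
               (∀ y → y ∈ ys → ∃[ x ] y ≡ f x) → ∃[ xs ] map f xs ≡ ys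
map-preimage f []       _   = [] , refl
map-preimage f (y ∷ ys) pre with pre y (here refl) | map-preimage f ys (λ z → pre z ∘ there)
... | x , refl | xs , refl = x ∷ xs , refl

module _ {m : ℕ} (H : Graph m) where

  Dominates : Fin m → Fin m → List (Fin m) → Set
  Dominates g' g S =
    g' ∈ S × g' ≢ g × (∀ h → h ∈ S → ClosedNbr H g h → ClosedNbr H g' h)

  Adj-sym : ∀ {a b} → Adj H a b → Adj H b a
  Adj-sym {a} {b} = subst T (sym H a b)

  Adj⇒≢ : ∀ {a b} → Adj H a b → a ≢ b
  Adj⇒≢ {a} a~a refl = subst T (irrefl H a) a~a

  dominator-adjacent : ∀ {g' g S} → g ∈ S → Dominates g' g S → Adj H g' g
  dominator-adjacent g∈S (_ , g'≢g , N[g]⊆N[g']) with N[g]⊆N[g'] _ g∈S (inj₁ refl)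
  ... | inj₁ refl = ⊥-elim (g'≢g refl)
  ... | inj₂ g'~g = g'~g

  apex-dominates : ∀ {a g S} → a ∈ S → a ≢ g →
                   (∀ h → h ∈ S → ClosedNbr H a h) → Dominates a g S
  apex-dominates a∈S a≢g apex = a∈S , a≢g , λ h h∈S _ → apex h h∈S

  seq-map : ∀ {P Q : Fin m → List (Fin m) → Set} →
            (∀ {g rest} → P g (g ∷ rest) → Q g (g ∷ rest)) →
            ∀ {l} → Seq H P l → Seq H Q l
  seq-map f (one g)    = one g
  seq-map f (step s p) = step (seq-map f s) (f p)

  dismantlable-cong : ∀ {U V : Fin m → Set} → (∀ v → U v ⇔ V v) →
                      Dismantlable H U → Dismantlable H V
  dismantlable-cong U⇔V (l , l-unique , l⇔U , s) =
    l , l-unique , (λ v → U⇔V v ⇔-∘ l⇔U v) , s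

  cone-seq : ∀ a r → (∀ v → v ∈ r → Adj H a v) →
             Seq H (DominatedIn H) (r ++ a ∷ [])
  cone-seq a []      _    = one a
  cone-seq a (h ∷ r) apex =
    step (cone-seq a r (λ v → apex v ∘ there))
         (a , apex-dominates (∈-++⁺ʳ (h ∷ r) (here refl))
                             (Adj⇒≢ (apex h (here refl))) closed)
    where
    closed : ∀ v → v ∈ h ∷ r ++ a ∷ [] → ClosedNbr H a v
    closed v v∈ with ∈-++⁻ (h ∷ r) v∈
    ... | inj₁ v∈r         = inj₂ (apex v v∈r)
    ... | inj₂ (here refl) = inj₁ refl

  cone-dismantlable : ∀ {U : Fin m → Set} → Decidable U → ∀ {a} → U a →
                      (∀ v → U v → ClosedNbr H a v) → Dismantlable H U
  cone-dismantlable {U} U? {a} Ua apex =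
    r ++ a ∷ [] , r++a-unique , r++a⇔U , cone-seq a r r-adjacent
    where
    Base : Fin m → Set
    Base v = U v × v ≢ a

    r : List (Fin m)
    r = filter (λ v → U? v ×-dec ¬? (v ≟ a)) (allFin m)

    ∈r⇒Base : ∀ {v} → v ∈ r → Base v
    ∈r⇒Base = proj₂ ∘ ∈-filter⁻ _ {xs = allFin m}

    r-adjacent : ∀ v → v ∈ r → Adj H a v
    r-adjacent v v∈r with ∈r⇒Base v∈r
    ... | Uv , v≢a with apex v Uv
    ...   | inj₁ v≡a  = ⊥-elim (v≢a v≡a)
    ...   | inj₂ a~v  = a~v

    r++a-unique : Unique (r ++ a ∷ [])
    r++a-unique = Unique.++⁺ (Unique.filter⁺ _ (Unique.allFin⁺ m)) ([] ∷ [])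
      (λ { (v∈r , here refl) → proj₂ (∈r⇒Base v∈r) refl })

    r++a⇔U : ∀ v → v ∈ r ++ a ∷ [] ⇔ U v
    r++a⇔U v = mk⇔ member⇒U U⇒member
      where
      member⇒U : v ∈ r ++ a ∷ [] → U v
      member⇒U v∈ with ∈-++⁻ r v∈
      ... | inj₁ v∈r         = proj₁ (∈r⇒Base v∈r)
      ... | inj₂ (here refl) = Ua

      U⇒member : U v → v ∈ r ++ a ∷ []
      U⇒member Uv with v ≟ a
      ... | yes refl = ∈-++⁺ʳ r (here refl)
      ... | no v≢a   = ∈-++⁺ˡ (∈-filter⁺ _ (∈-allFin v) (Uv , v≢a))

  -- The dominator g' lies in the link of g and is adjacent to all of it.
  dominated⇒sDismantlable : ∀ {g rest} → DominatedIn H g (g ∷ rest) →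
                            SDismantlableIn H g (g ∷ rest)
  dominated⇒sDismantlable {g} {rest} (g' , dom@(g'∈ , _ , N[g]⊆N[g'])) =
    cone-dismantlable
      (λ v → (v ∈? g ∷ rest) ×-dec T? (adj H g v))
      (g'∈ , Adj-sym (dominator-adjacent (here refl) dom))
      (λ v (v∈ , g~v) → N[g]⊆N[g'] v v∈ (inj₂ g~v))
    where open DecMembership (_≟_ {m}) using (_∈?_)

  dismantling⇒sCollapsing : ∀ {l} → Seq H (DominatedIn H) l →
                            Seq H (SDismantlableIn H) l
  dismantling⇒sCollapsing = seq-map dominated⇒sDismantlable

pattern north = zero
pattern south = suc zero
pattern ⇑_ g  = suc (suc g)

module Suspension {n : ℕ} (G : Graph n) where

  V : Set
  V = Fin (2 + n)

  SG : Graph (2 + n)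
  SG = Susp G

  open DecMembership (_≟_ {2 + n}) using (_∈?_)

  ⇑-injective : ∀ {g h : Fin n} → ⇑ g ≡ ⇑ h → g ≡ h
  ⇑-injective refl = refl

  ⇑-closedNbr : ∀ {g h} → ClosedNbr SG (⇑ g) (⇑ h) ⇔ ClosedNbr G g h
  ⇑-closedNbr = mk⇔ (map₁ ⇑-injective) (map₁ (cong ⇑_))

  data Pole : V → Set where
    north-pole : Pole north
    south-pole : Pole south

  pole-adjacent : ∀ {p} → Pole p → ∀ g → Adj SG p (⇑ g)
  pole-adjacent north-pole _ = tt
  pole-adjacent south-pole _ = tt

  pole-neighbour : ∀ {p} → Pole p → ∀ v → Adj SG p v → ∃[ g ] v ≡ ⇑ g
  pole-neighbour _          (⇑ g) _  = g , refl
  pole-neighbour north-pole north ()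
  pole-neighbour north-pole south ()
  pole-neighbour south-pole north ()
  pole-neighbour south-pole south ()

  -- A pole does not contain the other pole in its closed neighbourhood.
  base-dominator : ∀ {w g D} → north ∈ D → south ∈ D →
                   Dominates SG w (⇑ g) D → ∃[ g' ] w ≡ ⇑ g'
  base-dominator {⇑ g'} _ _ _ = g' , refl
  base-dominator {north} _ south∈ (_ , _ , N⊆N) with N⊆N south south∈ (inj₂ tt)
  ... | inj₂ ()
  base-dominator {south} north∈ _ (_ , _ , N⊆N) with N⊆N north north∈ (inj₂ tt)
  ... | inj₂ ()

  BasePart : List (Fin n) → List V → Set
  BasePart e D = ∀ g → g ∈ e ⇔ ⇑ g ∈ D

  basePart-∷ : ∀ {g e D} → BasePart e D → BasePart (g ∷ e) (⇑ g ∷ D)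
  basePart-∷ e≈D k = mk⇔ (λ { (here refl) → here refl
                            ; (there k∈e) → there (to (e≈D k) k∈e) })
                         (λ { (here eq)   → here (⇑-injective eq)
                            ; (there k∈D) → there (from (e≈D k) k∈D) })

  basePart-map : ∀ e → BasePart e (map ⇑_ e)
  basePart-map e g = mk⇔ (∈-map⁺ ⇑_) ⇑∈⇒∈
    where
    ⇑∈⇒∈ : ⇑ g ∈ map ⇑_ e → g ∈ e
    ⇑∈⇒∈ ⇑g∈ with ∈-map⁻ ⇑_ ⇑g∈
    ... | _ , g∈e , refl = g∈e

  basePart-∉ : ∀ {g e D} → BasePart e D → ⇑ g ∉ D → g ∉ e
  basePart-∉ {g} e≈D ⇑g∉D = ⇑g∉D ∘ to (e≈D g)

  dominates-suspend : ∀ {g' g e D} → BasePart e D →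
                      Dominates G g' g e → Dominates SG (⇑ g') (⇑ g) D
  dominates-suspend {g'} e≈D (g'∈e , g'≢g , N[g]⊆N[g']) =
    to (e≈D g') g'∈e , g'≢g ∘ ⇑-injective , closed
    where
    closed : ∀ v → v ∈ _ → ClosedNbr SG (⇑ _) v → ClosedNbr SG (⇑ g') v
    closed north _   _ = inj₂ tt
    closed south _   _ = inj₂ tt
    closed (⇑ h) ⇑h∈ c =
      from ⇑-closedNbr (N[g]⊆N[g'] h (from (e≈D h) ⇑h∈) (to ⇑-closedNbr c))

  dominates-desuspend : ∀ {g' g e D} → BasePart e D →
                        Dominates SG (⇑ g') (⇑ g) D → Dominates G g' g e
  dominates-desuspend {g'} e≈D (⇑g'∈D , ⇑g'≢⇑g , N[⇑g]⊆N[⇑g']) =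
    from (e≈D g') ⇑g'∈D , ⇑g'≢⇑g ∘ cong ⇑_ ,
    λ h h∈e c → to ⇑-closedNbr (N[⇑g]⊆N[⇑g'] (⇑ h) (to (e≈D h) h∈e) (from ⇑-closedNbr c))

  -- Lists are written last vertex first, so this is the order g₁, x, y, g₂, …, g_k.
  suspList : List (Fin n) → List V
  suspList []          = []
  suspList (g ∷ [])    = south ∷ north ∷ ⇑ g ∷ []
  suspList (g ∷ h ∷ r) = ⇑ g ∷ suspList (h ∷ r)

  north∈suspList : ∀ g r → north ∈ suspList (g ∷ r)
  north∈suspList _ []      = there (here refl)
  north∈suspList _ (h ∷ r) = there (north∈suspList h r)

  south∈suspList : ∀ g r → south ∈ suspList (g ∷ r)
  south∈suspList _ []      = here refl
  south∈suspList _ (h ∷ r) = there (south∈suspList h r)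

  basePart-suspList : ∀ l → BasePart l (suspList l)
  basePart-suspList []          _ = mk⇔ (λ ()) (λ ())
  basePart-suspList (g ∷ [])    k = mk⇔ (λ { (here refl) → there (there (here refl)) })
                                        (λ { (there (there (here refl))) → here refl })
  basePart-suspList (g ∷ h ∷ r) = basePart-∷ (basePart-suspList (h ∷ r))

  suspList-unique : ∀ {l} → Unique l → Unique (suspList l)
  suspList-unique {[]}        _ = []
  suspList-unique {g ∷ []}    _ = ((λ ()) ∷ (λ ()) ∷ []) ∷ ((λ ()) ∷ []) ∷ [] ∷ []
  suspList-unique {g ∷ h ∷ r} u@(_ ∷ r-unique) =
    ¬Any⇒All¬ _ (Unique.Unique[x∷xs]⇒x∉xs u ∘ from (basePart-suspList (h ∷ r) g))
    ∷ suspList-unique r-unique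

  link⇔ : ∀ {g e D} → BasePart e D →
          ∀ k → (k ∈ e × Adj G g k) ⇔ (⇑ k ∈ D × Adj SG (⇑ g) (⇑ k))
  link⇔ e≈D k = mk⇔ (Product.map₁ (to (e≈D k))) (Product.map₁ (from (e≈D k)))

  suspend-seq : ∀ {P : V → List V → Set} {Q : Fin n → List (Fin n) → Set} →
    (∀ g → Seq SG P (south ∷ north ∷ ⇑ g ∷ [])) →
    (∀ {g rest D} → north ∈ D → south ∈ D → BasePart (g ∷ rest) (⇑ g ∷ D) →
                    Q g (g ∷ rest) → P (⇑ g) (⇑ g ∷ D)) →
    ∀ {l} → Seq G Q l → Seq SG P (suspList l)
  suspend-seq start _ (one g) = start g
  suspend-seq start _ (step {rest = []} () _)
  suspend-seq start atBase (step {g} {h ∷ r} s q) =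
    step (suspend-seq start atBase s)
         (atBase (north∈suspList h r) (south∈suspList h r) (basePart-suspList (g ∷ h ∷ r)) q)

  poles-dominated : ∀ g → Seq SG (DominatedIn SG) (south ∷ north ∷ ⇑ g ∷ [])
  poles-dominated g =
    step (step (one (⇑ g))
               (⇑ g , apex-dominates SG (there (here refl)) (λ ()) (λ v → apex v ∘ there)))
         (⇑ g , apex-dominates SG (there (there (here refl))) (λ ()) apex)
    where
    apex : ∀ v → v ∈ south ∷ north ∷ ⇑ g ∷ [] → ClosedNbr SG (⇑ g) v
    apex north _                           = inj₂ tt
    apex south _                           = inj₂ tt
    apex (⇑ _) (there (there (here refl))) = inj₁ refl

  dismantlable-suspend : ∀ {U : V → Set} → U north → U south →
                         Dismantlable G (U ∘ ⇑_) → Dismantlable SG U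
  dismantlable-suspend _ _ ([] , _ , _ , ())
  dismantlable-suspend {U} Un Us (g ∷ r , l-unique , l⇔U , s) =
    suspList (g ∷ r) , suspList-unique l-unique , suspList⇔U ,
    suspend-seq poles-dominated
      (λ _ _ e≈D (g' , dom) → ⇑ g' , dominates-suspend e≈D dom) s
    where
    suspList⇔U : ∀ v → v ∈ suspList (g ∷ r) ⇔ U v
    suspList⇔U north = mk⇔ (const Un) (const (north∈suspList g r))
    suspList⇔U south = mk⇔ (const Us) (const (south∈suspList g r))
    suspList⇔U (⇑ h) = l⇔U h ⇔-∘ ⇔-sym (basePart-suspList (g ∷ r) h)

  sDismantlable-suspend : ∀ {g rest D} → north ∈ D → south ∈ D →
    BasePart (g ∷ rest) (⇑ g ∷ D) →
    SDismantlableIn G g (g ∷ rest) → SDismantlableIn SG (⇑ g) (⇑ g ∷ D)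
  sDismantlable-suspend north∈ south∈ e≈D =
    dismantlable-suspend (there north∈ , tt) (there south∈ , tt)
    ∘ dismantlable-cong G (link⇔ e≈D)

  sCollapsible-suspend : SCollapsible G → SCollapsible SG
  sCollapsible-suspend ([] , _ , _ , ())
  sCollapsible-suspend (g ∷ r , l-unique , every , s) =
    suspList (g ∷ r) , suspList-unique l-unique , every′ ,
    suspend-seq (dismantling⇒sCollapsing SG ∘ poles-dominated) sDismantlable-suspend s
    where
    every′ : ∀ v → v ∈ suspList (g ∷ r)
    every′ north = north∈suspList g r
    every′ south = south∈suspList g r
    every′ (⇑ h) = to (basePart-suspList (g ∷ r) h) (every h)

  Desuspension : (Fin n → List (Fin n) → Set) → List V → Set
  Desuspension Q D = ∃[ e ] (Unique e × BasePart e D × Seq G Q e)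

  -- Reads L down to its last-added pole, above which both poles are present.
  desuspend-seq : ∀ {P : V → List V → Set} {Q : Fin n → List (Fin n) → Set} →
    (∀ {p rest} → Pole p → P p (p ∷ rest) → Desuspension Q (p ∷ rest)) →
    (∀ {g e rest} → north ∈ rest → south ∈ rest → BasePart (g ∷ e) (⇑ g ∷ rest) →
                    P (⇑ g) (⇑ g ∷ rest) → Q g (g ∷ e)) →
    ∀ {L} → Seq SG P L → Unique L → north ∈ L → south ∈ L → Desuspension Q L
  desuspend-seq _ _ (one _) _ (here refl) (here ())
  desuspend-seq _ _ (one _) _ (here refl) (there ())
  desuspend-seq _ _ (one _) _ (there ()) _
  desuspend-seq atPole _ (step {north} _ p) _ _ _ = atPole north-pole p
  desuspend-seq atPole _ (step {south} _ p) _ _ _ = atPole south-pole p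
  desuspend-seq atPole atBase (step {⇑ g} {rest} s p) (⇑g∉ ∷ u) (there north∈) (there south∈)
    with desuspend-seq atPole atBase s u north∈ south∈
  ... | e , e-unique , e≈rest , s′ =
    g ∷ e , g∉e ∷ e-unique , g∷e≈ , step s′ (atBase north∈ south∈ g∷e≈ p)
    where
    g∷e≈ : BasePart (g ∷ e) (⇑ g ∷ rest)
    g∷e≈ = basePart-∷ e≈rest

    g∉e : All (g ≢_) e
    g∉e = ¬Any⇒All¬ e (basePart-∉ e≈rest (All¬⇒¬Any ⇑g∉))

  -- The dominator of a pole is a vertex of G adjacent to all other vertices of G present.
  dominated-pole⇒dismantlable-base : ∀ {p rest} → Pole p → DominatedIn SG p (p ∷ rest) →
                                     Dismantlable G (λ g → ⇑ g ∈ p ∷ rest)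
  dominated-pole⇒dismantlable-base {p} {rest} pole (w , dom@(w∈ , _ , N[p]⊆N[w]))
    with pole-neighbour pole w (Adj-sym SG {w} (dominator-adjacent SG (here refl) dom))
  ... | _ , refl =
    cone-dismantlable G (λ g → ⇑ g ∈? p ∷ rest) w∈
      (λ g ⇑g∈ → to ⇑-closedNbr (N[p]⊆N[w] (⇑ g) ⇑g∈ (inj₂ (pole-adjacent pole g))))

  dominated-desuspend : ∀ {g e D} → north ∈ D → south ∈ D → BasePart e D →
                        DominatedIn SG (⇑ g) D → DominatedIn G g e
  dominated-desuspend north∈ south∈ e≈D (_ , dom) with base-dominator north∈ south∈ dom
  ... | g' , refl = g' , dominates-desuspend e≈D dom

  dismantlable-desuspend : ∀ {U : V → Set} → U north → U south →
                           Dismantlable SG U → Dismantlable G (U ∘ ⇑_)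
  dismantlable-desuspend Un Us (L , L-unique , L⇔U , s) =
    dismantlable-cong G (λ g → L⇔U (⇑ g))
      (desuspend-seq dominated-pole⇒dismantlable-base
        (λ north∈ south∈ → dominated-desuspend (there north∈) (there south∈))
        s L-unique (from (L⇔U north) Un) (from (L⇔U south) Us))

  desuspend-base-seq : ∀ {e} → Seq SG (DominatedIn SG) (map ⇑_ e) → Seq G (DominatedIn G) e
  desuspend-base-seq {[]} ()
  desuspend-base-seq {g ∷ []} (one _) = one g
  desuspend-base-seq {g ∷ []} (step () _)
  desuspend-base-seq {e@(_ ∷ _ ∷ _)} (step s (_ , dom)) with ∈-map⁻ ⇑_ (proj₁ dom)
  ... | g' , _ , refl = step (desuspend-base-seq s) (g' , dominates-desuspend (basePart-map e) dom)

  dismantlable-desuspend-base : ∀ {U : V → Set} → (∀ v → U v → ∃[ g ] v ≡ ⇑ g) →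
                                Dismantlable SG U → Dismantlable G (U ∘ ⇑_)
  dismantlable-desuspend-base base (d , d-unique , d⇔U , s)
    with map-preimage ⇑_ d (λ v → base v ∘ to (d⇔U v))
  ... | e , refl =
    e , Unique.map⁻ d-unique , (λ g → d⇔U (⇑ g) ⇔-∘ basePart-map e g) , desuspend-base-seq s

  sDismantlable-pole⇒sCollapsible-base : ∀ {p rest} → Pole p →
    SDismantlableIn SG p (p ∷ rest) → Desuspension (SDismantlableIn G) (p ∷ rest)
  sDismantlable-pole⇒sCollapsible-base pole link =
    let e , e-unique , e≈ , s =
          dismantlable-cong G (λ g → mk⇔ proj₁ (_, pole-adjacent pole g))
            (dismantlable-desuspend-base (λ v → pole-neighbour pole v ∘ proj₂) link)
    in e , e-unique , e≈ , dismantling⇒sCollapsing G s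

  sDismantlable-desuspend : ∀ {g e rest} → north ∈ rest → south ∈ rest →
    BasePart (g ∷ e) (⇑ g ∷ rest) →
    SDismantlableIn SG (⇑ g) (⇑ g ∷ rest) → SDismantlableIn G g (g ∷ e)
  sDismantlable-desuspend north∈ south∈ e≈D =
    dismantlable-cong G (⇔-sym ∘ link⇔ e≈D)
    ∘ dismantlable-desuspend (there north∈ , tt) (there south∈ , tt)

  sCollapsible-desuspend : SCollapsible SG → SCollapsible G
  sCollapsible-desuspend (L , L-unique , every , s) =
    let e , e-unique , e≈L , s′ =
          desuspend-seq sDismantlable-pole⇒sCollapsible-base sDismantlable-desuspend
                        s L-unique (every north) (every south)
    in e , e-unique , (λ g → from (e≈L g) (every (⇑ g))) , s′

open Suspension using (sCollapsible-suspend; sCollapsible-desuspend)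

proposition1p10 : ∀ {n : ℕ} (G : Graph n) → SCollapsible G ⇔ SCollapsible (Susp G)
proposition1p10 G = mk⇔ (sCollapsible-suspend G) (sCollapsible-desuspend G)
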